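{- Fix $d\geq1$, $X=\mathbb{N}^d$, $\Gamma=\mathbb{N}^d$. For every $x\in X$ and $a,b\in\Gamma$, if $g^a(x)=g^b(x)$ then $a=b$.
   Context: For $x=(n_1,\dots,n_d)\in X$, $\Delta(x)=\{(1,n_1),\dots,(d,n_d)\}\subseteq[d]\times\mathbb{N}$ (conversely $d$ points with distinct first coordinates determine an element of $X$). For $\delta=(i,n)$, seat $i(\delta)=i$, height $h(\delta)=n+i/d$; points ordered by height; $\delta+s/d$ is the point of height $h(\delta)+s/d$. $\Delta(x)=\{\delta^1(x)\prec\cdots\prec\delta^d(x)\}$. Operator $g_j:X\to X$ ($j\in[d]$): $g_j(x)=x'$ with $\delta^k(x')=\delta^k(x)$ for $k<j$ and $\delta^k(x')=\delta^k(x)+s_k/d$ for $k\geq j$, $s_k$ the smallest positive integer with the seat of $\delta^k(x)+s_k/d$ in $\{i(\delta^j(x)),\dots,i(\delta^d(x))\}$. For $a=(a_1,\dots,a_d)\in\Gamma$, $g^a=g_1^{a_1}\circ\cdots\circ g_d^{a_d}$. -}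

module Defs where

open import Data.Nat using (ℕ; zero; suc; _+_; _*_; _<?_; _≤?_; NonZero)
open import Data.Nat.DivMod using (_/_; _mod_)
open import Data.Fin using (Fin; toℕ; _≟_)
open import Data.Vec using (Vec; lookup; tabulate)
open import Data.List using (List; []; _∷_; length; filter; map; foldr)
open import Data.List.Base using (allFin)
open import Relation.Nullary using (yes; no)
import Data.Bool

-- Conventions:
--  * X = ℕ^d is  Vec ℕ d ; the paper's seat i ∈ [d] = {1..d} is  Fin d  (paper i = toℕ i + 1).
--  * A point (i , n) of [d] × ℕ is encoded by the natural number
--      H = n * d + (i - 1)   = d * h(δ) - 1,
--    a bijection [d] × ℕ ≅ ℕ that preserves the height order;
--    "δ + s/d" is H + s, the seat of H is H mod d and its level is H / d.

module _ (d : ℕ) .{{_ : NonZero d}} where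

  height : Vec ℕ d → Fin d → ℕ
  height x i = lookup x i * d + toℕ i

  seat : ℕ → Fin d
  seat H = H mod d

  level : ℕ → ℕ
  level H = H / d

  -- rank x i = k - 1 where δ^k(x) is the point with seat i
  rank : Vec ℕ d → Fin d → ℕ
  rank x i = length (filter (λ i' → height x i' <? height x i) (allFin d))

  -- seat i belongs to {i(δ^j(x)), …, i(δ^d(x))}, for paper index j = toℕ j + 1
  active : Vec ℕ d → Fin d → Fin d → Set
  active x j i = toℕ j Data.Nat.≤ rank x i

  active? : (x : Vec ℕ d) (j i : Fin d) → Data.Bool.Bool
  active? x j i with toℕ j ≤? rank x i
  ... | yes _ = Data.Bool.true
  ... | no  _ = Data.Bool.false

  -- first candidate among c, c+1, …, c+fuel-1 whose seat is active
  -- (returns c+fuel if none; with fuel = d and c = H+1 this never happens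
  -- for an active point, since H + d has the same seat as H)
  search : Vec ℕ d → Fin d → ℕ → ℕ → ℕ
  search x j zero c = c
  search x j (suc f) c with active? x j (seat c)
  ... | Data.Bool.true  = c
  ... | Data.Bool.false = search x j f (suc c)

  -- δ + s/d with s the smallest positive integer whose seat is active
  shift : Vec ℕ d → Fin d → ℕ → ℕ
  shift x j H = search x j d (suc H)

  newPoint : Vec ℕ d → Fin d → Fin d → ℕ
  newPoint x j i with active? x j i
  ... | Data.Bool.true  = shift x j (height x i)
  ... | Data.Bool.false = height x i

  -- d points with distinct seats determine an element of X:
  -- coordinate k is the level of the (first) point in the list with seat k
  levelAt : List ℕ → Fin d → ℕ
  levelAt [] k = 0
  levelAt (H ∷ Hs) k with seat H ≟ k
  ... | yes _ = level H
  ... | no  _ = levelAt Hs k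

  fromPoints : List ℕ → Vec ℕ d
  fromPoints Hs = tabulate (levelAt Hs)

  -- the operator g_j, paper index j = toℕ j + 1
  g : Fin d → Vec ℕ d → Vec ℕ d
  g j x = fromPoints (map (newPoint x j) (allFin d))

  iter : {A : Set} → (A → A) → ℕ → A → A
  iter f zero y = y
  iter f (suc n) y = f (iter f n y)

  gPow : Vec ℕ d → Vec ℕ d → Vec ℕ d
  gPow a x = foldr (λ j y → iter (g j) (lookup a j) y) x (allFin d)

-- Let k be the first index with a_k ≠ b_k, say a_k < b_k, and let t be the point of x
-- of rank k.  The operators g_j with j > k, applied first, fix every point of height
-- at most t.  Then g_k, applied to a configuration whose point t has rank k, moves t and
-- everything above it while fixing everything below; so after the b_k - a_k surplus
-- applications on the b side we reach configurations z, z' that have the same points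
-- below t, with t a point of z but not of z', and with rank at least k in z.  Every g_j
-- with j ≤ k preserves this shape: the two configurations have the same active seats,
-- so they move their common points alike, and t is replaced by the next active position
-- above it, which is again a point of the first configuration only.
module Submission where

open import Defs
open import Data.Bool using (Bool; true; false)
import Data.Bool.Properties as Boolₚ
open import Data.Empty using (⊥-elim)
open import Data.Fin as Fin using (Fin; toℕ)
import Data.Fin.Properties as Finₚ
open import Data.Fin.Permutation using (Permutation; permutation)
open import Data.List as List using ([]; _∷_; _++_; length; filter; map; foldr; allFin)
import Data.List.Properties as Listₚ
open import Data.List.Membership.Propositional using (_∈_)
open import Data.List.Membership.Propositional.Properties using (∈-map⁺; ∈-map⁻; ∈-allFin)
open import Data.List.Relation.Unary.All as All using (All; []; _∷_)
import Data.List.Relation.Unary.All.Properties as Allₚ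
open import Data.List.Relation.Unary.Any using (here; there)
import Data.List.Relation.Unary.Any.Properties as Anyₚ
open import Data.List.Relation.Binary.Sublist.Heterogeneous.Properties using (length-mono-≤; ⊆-filter-Sublist)
open import Data.List.Relation.Binary.Sublist.Propositional using (⊆-refl)
open import Data.Nat using (ℕ; NonZero; >-nonZero⁻¹; zero; suc; _+_; _*_; _≤_; _<_; z≤n; s≤s; _%_; _/_)
open import Data.Nat.Properties
open import Data.Nat.DivMod using ([m+kn]%n≡m%n; m%n%n≡m%n; m≡m%n+[m/n]*n; m<n⇒m%n≡m; m%n<n)
open import Data.Product using (∃; _×_; _,_; proj₁; proj₂)
open import Data.Sum using (inj₁; inj₂)
open import Data.Vec as Vec using (Vec; lookup)
import Data.Vec.Properties as Vecₚ
open import Level using (Level)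
open import Function using (_∘_; id)
open import Function.Definitions using (Injective)
open import Relation.Binary.Definitions using (tri<; tri≈; tri>)
open import Relation.Binary.PropositionalEquality
open import Relation.Nullary using (¬_; Dec; yes; no)
open import Relation.Unary using (Pred; Decidable; _⊆_; _≐_)
import Algebra.Properties.CommutativeMonoid.Sum as MonoidSum
import Data.Fin.Induction as FinInduction
open import Induction.WellFounded using (module All)

private
  variable
    a p q : Level
    B : Set a

module _ {P : Pred B p} {Q : Pred B q} (P? : Decidable P) (Q? : Decidable Q) where

  length-filter-mono-≤ : P ⊆ Q → ∀ xs → length (filter P? xs) ≤ length (filter Q? xs)
  length-filter-mono-≤ P⊆Q xs =
    length-mono-≤ (⊆-filter-Sublist P? Q? (λ { refl → P⊆Q }) (⊆-refl {x = xs}))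

  length-filter-mono-< : P ⊆ Q → ∀ {xs y} → y ∈ xs → ¬ P y → Q y →
                         length (filter P? xs) < length (filter Q? xs)
  length-filter-mono-< P⊆Q {x ∷ xs} (here refl) ¬Py Qy with P? x | Q? x
  ... | yes Px | _    = ⊥-elim (¬Py Px)
  ... | no _   | yes _ = s≤s (length-filter-mono-≤ P⊆Q xs)
  ... | no _   | no ¬Qx = ⊥-elim (¬Qx Qy)
  length-filter-mono-< P⊆Q {x ∷ xs} (there y∈xs) ¬Py Qy with P? x | Q? x
  ... | yes Px | no ¬Qx = ⊥-elim (¬Qx (P⊆Q Px))
  ... | yes _  | yes _  = s≤s (length-filter-mono-< P⊆Q y∈xs ¬Py Qy)
  ... | no _   | yes _  = m≤n⇒m≤1+n (length-filter-mono-< P⊆Q y∈xs ¬Py Qy)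
  ... | no _   | no _   = length-filter-mono-< P⊆Q y∈xs ¬Py Qy

injective⇒surjective : ∀ {n} (f : Fin n → Fin n) → Injective _≡_ _≡_ f → ∀ k → ∃ λ i → f i ≡ k
injective⇒surjective {zero}  f f-inj ()
injective⇒surjective {suc n} f f-inj k with Finₚ.any? (λ i → f i Finₚ.≟ k)
... | yes hit = hit
... | no miss = ⊥-elim (Finₚ.<⇒notInjective (n<1+n n) punchOut-f-injective)
  where
  k≢f : ∀ i → k ≢ f i
  k≢f i k≡fi = miss (i , sym k≡fi)
  punchOut-f-injective : Injective _≡_ _≡_ (λ i → Fin.punchOut (k≢f i))
  punchOut-f-injective eq = f-inj (Finₚ.punchOut-injective (k≢f _) (k≢f _) eq)

open MonoidSum +-0-commutativeMonoid using (sum; sum-permute)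

private
  indicator : {P : Set p} → Dec P → ℕ
  indicator (yes _) = 1
  indicator (no _)  = 0

  length-filter-tabulate : ∀ {n} {P : Pred B p} (P? : Decidable P) (f : Fin n → B) →
    length (filter P? (List.tabulate f)) ≡ sum (λ i → indicator (P? (f i)))
  length-filter-tabulate {n = zero}  P? f = refl
  length-filter-tabulate {n = suc n} P? f with P? (f Fin.zero)
  ... | yes _ = cong suc (length-filter-tabulate P? (f ∘ Fin.suc))
  ... | no _  = length-filter-tabulate P? (f ∘ Fin.suc)

length-filter-permute : ∀ {n} {P : Pred (Fin n) p} (P? : Decidable P) (π : Fin n → Fin n) →
  Injective _≡_ _≡_ π → length (filter P? (allFin n)) ≡ length (filter (P? ∘ π) (allFin n))
length-filter-permute P? π π-inj = begin
  length (filter P? (allFin _))          ≡⟨ length-filter-tabulate P? id ⟩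
  sum (λ i → indicator (P? i))           ≡⟨ sum-permute (λ i → indicator (P? i)) π′ ⟩
  sum (λ i → indicator (P? (π i)))       ≡⟨ length-filter-tabulate (P? ∘ π) id ⟨
  length (filter (P? ∘ π) (allFin _))    ∎
  where
  open ≡-Reasoning
  π⁻¹ = injective⇒surjective π π-inj
  π′ : Permutation _ _
  π′ = permutation π (proj₁ ∘ π⁻¹) (proj₂ ∘ π⁻¹) (λ i → π-inj (proj₂ (π⁻¹ (π i))))

foldr-preserves : ∀ {C : Set} {Q : B → Set} (P : C → Set) (f : B → C → C) →
                  (∀ {b c} → Q b → P c → P (f b c)) → ∀ {c bs} → All Q bs → P c → P (foldr f c bs)
foldr-preserves P f pres []         Pc = Pc
foldr-preserves P f pres (Qb ∷ Qbs) Pc = pres Qb (foldr-preserves P f pres Qbs Pc)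

foldr-preserves₂ : ∀ {C : Set} {Q : B → Set} (R : C → C → Set) (f f' : B → C → C) →
                   (∀ {b c c'} → Q b → R c c' → R (f b c) (f' b c')) →
                   ∀ {c c' bs} → All Q bs → R c c' → R (foldr f c bs) (foldr f' c' bs)
foldr-preserves₂ R f f' pres []         Rcc' = Rcc'
foldr-preserves₂ R f f' pres (Qb ∷ Qbs) Rcc' = pres Qb (foldr-preserves₂ R f f' pres Qbs Rcc')

allFin-split : ∀ {n} (k : Fin n) → ∃ λ pre → ∃ λ suf →
               allFin n ≡ pre ++ k ∷ suf × All (Fin._< k) pre × All (k Fin.<_) suf
allFin-split {suc n} Fin.zero = [] , List.tabulate Fin.suc , refl , [] , Allₚ.tabulate⁺ (λ _ → s≤s z≤n)
allFin-split {suc n} (Fin.suc k) with allFin-split k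
... | pre , suf , allFin≡ , pre<k , k<suf =
  Fin.zero ∷ map Fin.suc pre , map Fin.suc suf ,
  cong (Fin.zero ∷_) (begin
    List.tabulate Fin.suc          ≡⟨ Listₚ.map-tabulate id Fin.suc ⟨
    map Fin.suc (allFin n)         ≡⟨ cong (map Fin.suc) allFin≡ ⟩
    map Fin.suc (pre ++ k ∷ suf)   ≡⟨ Listₚ.map-++ Fin.suc pre (k ∷ suf) ⟩
    map Fin.suc pre ++ Fin.suc k ∷ map Fin.suc suf ∎) ,
  s≤s z≤n ∷ Allₚ.map⁺ (All.map s≤s pre<k) , Allₚ.map⁺ (All.map s≤s k<suf)
  where open ≡-Reasoning

module _ (d : ℕ) .{{_ : NonZero d}} where

  private
    0<d : 0 < d
    0<d = >-nonZero⁻¹ d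

  toℕ-seat : ∀ H → toℕ (seat d H) ≡ H % d
  toℕ-seat H = Finₚ.toℕ-fromℕ< (m%n<n H d)

  seat-+-* : ∀ H q → seat d (H + q * d) ≡ seat d H
  seat-+-* H q = Finₚ.fromℕ<-cong _ _ ([m+kn]%n≡m%n H q d) _ _

  seat-+-d : ∀ H → seat d (H + d) ≡ seat d H
  seat-+-d H = trans (cong (λ m → seat d (H + m)) (sym (*-identityˡ d))) (seat-+-* H 1)

  seat-toℕ : (i : Fin d) → seat d (toℕ i) ≡ i
  seat-toℕ i = Finₚ.toℕ-injective (trans (toℕ-seat (toℕ i)) (m<n⇒m%n≡m (Finₚ.toℕ<n i)))

  seat-height : ∀ x i → seat d (height d x i) ≡ i
  seat-height x i = trans (trans (cong (seat d) (+-comm (lookup x i * d) (toℕ i)))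
                                 (seat-+-* (toℕ i) (lookup x i)))
                          (seat-toℕ i)

  height-injective : ∀ x y i → height d x i ≡ height d y i → lookup x i ≡ lookup y i
  height-injective x y i eq = *-cancelʳ-≡ (lookup x i) (lookup y i) d (+-cancelʳ-≡ (toℕ i) _ _ eq)

  height-cong : ∀ x y i → lookup x i ≡ lookup y i → height d x i ≡ height d y i
  height-cong x y i = cong (λ n → n * d + toℕ i)

  height-level : ∀ x H → lookup x (seat d H) ≡ level d H → height d x (seat d H) ≡ H
  height-level x H x≡level = begin
    lookup x (seat d H) * d + toℕ (seat d H)  ≡⟨ cong₂ (λ m r → m * d + r) x≡level (toℕ-seat H) ⟩
    H / d * d + H % d                        ≡⟨ +-comm (H / d * d) (H % d) ⟩
    H % d + H / d * d                        ≡⟨ m≡m%n+[m/n]*n H d ⟨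
    H                                        ∎
    where open ≡-Reasoning

  seat-≢-close : ∀ {u v} → u < v → v < u + d → seat d u ≢ seat d v
  seat-≢-close {u} {v} u<v v<u+d seat-u≡v = <-irrefl refl (<-≤-trans v<u+d u+d≤v)
    where
    r = u % d
    v%d≡r : v % d ≡ r
    v%d≡r = trans (sym (toℕ-seat v)) (trans (cong toℕ (sym seat-u≡v)) (toℕ-seat u))
    u≡ : u ≡ r + u / d * d
    u≡ = m≡m%n+[m/n]*n u d
    v≡ : v ≡ r + v / d * d
    v≡ = trans (m≡m%n+[m/n]*n v d) (cong (_+ v / d * d) v%d≡r)
    u/d<v/d : u / d < v / d
    u/d<v/d = *-cancelʳ-< _ (u / d) (v / d) (+-cancelˡ-< r _ _ (subst₂ _<_ u≡ v≡ u<v))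
    u+d≤v : u + d ≤ v
    u+d≤v = begin
      u + d                  ≡⟨ cong (_+ d) u≡ ⟩
      r + u / d * d + d      ≡⟨ +-assoc r _ d ⟩
      r + (u / d * d + d)    ≡⟨ cong (r +_) (+-comm (u / d * d) d) ⟩
      r + suc (u / d) * d    ≤⟨ +-monoʳ-≤ r (*-monoˡ-≤ d u/d<v/d) ⟩
      r + v / d * d          ≡⟨ v≡ ⟨
      v                      ∎
      where open ≤-Reasoning

  -- search and newPoint with the set A of active seats abstracted, so that two
  -- configurations with the same active seats can be compared.
  next : (Fin d → Bool) → ℕ → ℕ → ℕ
  next A zero    c = c
  next A (suc f) c with A (seat d c)
  ... | true  = c
  ... | false = next A f (suc c)

  advance : (Fin d → Bool) → ℕ → ℕ
  advance A H with A (seat d H)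
  ... | true  = next A d (suc H)
  ... | false = H

  next-cong : ∀ {A B} → (∀ s → A s ≡ B s) → ∀ f c → next A f c ≡ next B f c
  next-cong A≗B zero    c = refl
  next-cong {A} {B} A≗B (suc f) c with A (seat d c) | B (seat d c) | A≗B (seat d c)
  ... | true  | true  | _ = refl
  ... | false | false | _ = next-cong A≗B f (suc c)

  advance-cong : ∀ {A B} → (∀ s → A s ≡ B s) → ∀ H → advance A H ≡ advance B H
  advance-cong {A} {B} A≗B H with A (seat d H) | B (seat d H) | A≗B (seat d H)
  ... | true  | true  | _ = next-cong A≗B d (suc H)
  ... | false | false | _ = refl

  module _ (A : Fin d → Bool) where

    next-≥ : ∀ f c → c ≤ next A f c
    next-≥ zero    c = ≤-refl
    next-≥ (suc f) c with A (seat d c)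
    ... | true  = ≤-refl
    ... | false = ≤-trans (n≤1+n c) (next-≥ f (suc c))

    next-minimal : ∀ f c m → c ≤ m → m < c + f → A (seat d m) ≡ true →
                   next A f c ≤ m × A (seat d (next A f c)) ≡ true
    next-minimal zero    c m c≤m m<c+0 _ = ⊥-elim (<⇒≱ m<c+0 (subst (_≤ m) (sym (+-identityʳ c)) c≤m))
    next-minimal (suc f) c m c≤m m<c+f Am with A (seat d c) in Ac
    ... | true  = c≤m , Ac
    ... | false with m≤n⇒m<n∨m≡n c≤m
    ...   | inj₁ c<m  = next-minimal f (suc c) m c<m (subst (m <_) (+-suc c f) m<c+f) Am
    ...   | inj₂ refl with () ← trans (sym Ac) Am

    next-+-* : ∀ f c q → next A f (c + q * d) ≡ next A f c + q * d
    next-+-* zero    c q = refl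
    next-+-* (suc f) c q rewrite seat-+-* c q with A (seat d c)
    ... | true  = refl
    ... | false = next-+-* f (suc c) q

    advance-inactive : ∀ {H} → A (seat d H) ≡ false → advance A H ≡ H
    advance-inactive {H} AH with A (seat d H)
    ... | false = refl

    advance-active : ∀ {H} → A (seat d H) ≡ true → advance A H ≡ next A d (suc H)
    advance-active {H} AH with A (seat d H)
    ... | true = refl

    advance-≥ : ∀ H → H ≤ advance A H
    advance-≥ H with A (seat d H)
    ... | true  = ≤-trans (n≤1+n H) (next-≥ d (suc H))
    ... | false = ≤-refl

    advance-+-* : ∀ H q → advance A (H + q * d) ≡ advance A H + q * d
    advance-+-* H q rewrite seat-+-* H q with A (seat d H)
    ... | true  = next-+-* d (suc H) q
    ... | false = refl

    module _ {H} (AH : A (seat d H) ≡ true) where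

      advance-> : H < advance A H
      advance-> = subst (H <_) (sym (advance-active AH)) (next-≥ d (suc H))

      -- H + d has the seat of H, so the search always succeeds within d steps.
      private
        next-finds : next A d (suc H) ≤ H + d × A (seat d (next A d (suc H))) ≡ true
        next-finds = next-minimal d (suc H) (H + d) (m<m+n H 0<d) (n<1+n (H + d))
                                  (trans (cong A (seat-+-d H)) AH)

      advance-seat-active : A (seat d (advance A H)) ≡ true
      advance-seat-active = subst (λ n → A (seat d n) ≡ true) (sym (advance-active AH)) (proj₂ next-finds)

      advance-minimal : ∀ {H'} → H < H' → A (seat d H') ≡ true → advance A H ≤ H'
      advance-minimal {H'} H<H' AH' rewrite advance-active AH with H' <? suc H + d
      ... | yes H'<H+1+d = proj₁ (next-minimal d (suc H) H' H<H' H'<H+1+d AH')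
      ... | no  H'≮H+1+d = ≤-trans (proj₁ next-finds) (≤-trans (n≤1+n (H + d)) (≮⇒≥ H'≮H+1+d))

    advance-mono-< : ∀ {H H'} → H < H' → A (seat d H') ≡ true → advance A H < advance A H'
    advance-mono-< {H} {H'} H<H' AH' with A (seat d H) Boolₚ.≟ true
    ... | yes AH = ≤-<-trans (advance-minimal AH H<H' AH') (advance-> AH')
    ... | no ¬AH = subst (_< advance A H') (sym (advance-inactive (Boolₚ.¬-not ¬AH)))
                         (<-trans H<H' (advance-> AH'))

    module _ {t} (At : A (seat d t)  ≡ true) {H} (AH : t ≤ H → A (seat d H) ≡ true) where

      advance-cancel-< : advance A H < advance A t → H < t
      advance-cancel-< adv-H<adv-t with <-cmp H t
      ... | tri< H<t _ _ = H<t
      ... | tri≈ _ refl _ = ⊥-elim (<-irrefl refl adv-H<adv-t)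
      ... | tri> _ _ t<H = ⊥-elim (<-asym adv-H<adv-t (advance-mono-< t<H (AH (<⇒≤ t<H))))

      advance-injective : advance A H ≡ advance A t → H ≡ t
      advance-injective adv-H≡adv-t with <-cmp H t
      ... | tri< H<t _ _ = ⊥-elim (<-irrefl adv-H≡adv-t (advance-mono-< H<t At))
      ... | tri≈ _ H≡t _ = H≡t
      ... | tri> _ _ t<H = ⊥-elim (<-irrefl (sym adv-H≡adv-t) (advance-mono-< t<H (AH (<⇒≤ t<H))))

    private
      seat-advance-≢-close : ∀ {H H'} → A (seat d H) ≡ true → A (seat d H') ≡ true →
                             H < H' → H' < H + d → seat d (advance A H) ≢ seat d (advance A H')
      seat-advance-≢-close {H} {H'} AH AH' H<H' H'<H+d =
        seat-≢-close (≤-<-trans (advance-minimal AH H<H' AH') (advance-> AH')) adv-H'<adv-H+d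
        where
        adv-H'<adv-H+d : advance A H' < advance A H + d
        adv-H'<adv-H+d = ≤-<-trans (advance-minimal AH' H'<H+d (trans (cong A (seat-+-d H)) AH))
                                   (+-monoˡ-< d (advance-> AH))

      seat-advance-residue : ∀ H → seat d (advance A H) ≡ seat d (advance A (H % d))
      seat-advance-residue H = begin
        seat d (advance A H)                      ≡⟨ cong (seat d ∘ advance A) (m≡m%n+[m/n]*n H d) ⟩
        seat d (advance A (H % d + H / d * d))    ≡⟨ cong (seat d) (advance-+-* (H % d) (H / d)) ⟩
        seat d (advance A (H % d) + H / d * d)    ≡⟨ seat-+-* _ (H / d) ⟩
        seat d (advance A (H % d))                ∎
        where open ≡-Reasoning

      A-residue : ∀ {K} → A (seat d K) ≡ true → A (seat d (K % d)) ≡ true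
      A-residue {K} AK = trans (cong A (Finₚ.fromℕ<-cong _ _ (m%n%n≡m%n K d) _ _)) AK
      residue-eq : ∀ {K K'} → seat d (advance A K) ≡ seat d (advance A K') →
                   seat d (advance A (K % d)) ≡ seat d (advance A (K' % d))
      residue-eq {K} {K'} e = trans (sym (seat-advance-residue K)) (trans e (seat-advance-residue K'))

    -- Reduce both points to residues in [0, d), which are closer than d to each other.
    seat-advance-injective : ∀ {H H'} → A (seat d H) ≡ true → A (seat d H') ≡ true →
                             seat d (advance A H) ≡ seat d (advance A H') → seat d H ≡ seat d H'
    seat-advance-injective {H} {H'} AH AH' eq with <-cmp (H % d) (H' % d)
    ... | tri≈ _ r≡r' _ = Finₚ.fromℕ<-cong _ _ r≡r' _ _
    ... | tri< r<r' _ _ = ⊥-elim (seat-advance-≢-close (A-residue AH) (A-residue AH') r<r'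
                              (<-≤-trans (m%n<n H' d) (m≤n+m d (H % d))) (residue-eq eq))
    ... | tri> _ _ r'<r = ⊥-elim (seat-advance-≢-close (A-residue AH') (A-residue AH) r'<r
                              (<-≤-trans (m%n<n H d) (m≤n+m d (H' % d))) (residue-eq (sym eq)))

  countBelow : Vec ℕ d → ℕ → ℕ
  countBelow x H = length (filter (λ i → height d x i <? H) (allFin d))

  countBelow-mono-≤ : ∀ x {H H'} → H ≤ H' → countBelow x H ≤ countBelow x H'
  countBelow-mono-≤ x H≤H' = length-filter-mono-≤ _ _ (λ h<H → <-≤-trans h<H H≤H') (allFin d)

  rank<countBelow : ∀ x i {H} → height d x i < H → rank d x i < countBelow x H
  rank<countBelow x i h<H =
    length-filter-mono-< _ _ (λ h'<h → <-trans h'<h h<H) (∈-allFin i) (<-irrefl refl) h<H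

  rank<d : ∀ x i → rank d x i < d
  rank<d x i = subst (rank d x i <_) (Listₚ.length-tabulate id)
    (Listₚ.filter-notAll _ (allFin d) (Anyₚ.tabulate⁺ i (<-irrefl refl)))

  rank-injective : ∀ x {i i'} → rank d x i ≡ rank d x i' → i ≡ i'
  rank-injective x {i} {i'} eq with <-cmp (height d x i) (height d x i')
  ... | tri< h<h' _ _ = ⊥-elim (<-irrefl eq (rank<countBelow x i h<h'))
  ... | tri≈ _ h≡h' _ = trans (sym (seat-height x i)) (trans (cong (seat d) h≡h') (seat-height x i'))
  ... | tri> _ _ h'<h = ⊥-elim (<-irrefl (sym eq) (rank<countBelow x i' h'<h))

  rank-surjective : ∀ x (k : Fin d) → ∃ λ i → rank d x i ≡ toℕ k
  rank-surjective x k with injective⇒surjective rankFin rankFin-injective k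
    where
    rankFin : Fin d → Fin d
    rankFin i = Fin.fromℕ< (rank<d x i)
    rankFin-injective : Injective _≡_ _≡_ rankFin
    rankFin-injective eq = rank-injective x (Finₚ.fromℕ<-injective _ _ _ _ eq)
  ... | i , rankFin-i≡k = i , trans (sym (Finₚ.toℕ-fromℕ< (rank<d x i))) (cong toℕ rankFin-i≡k)

  active?-true : ∀ x j s → toℕ j ≤ rank d x s → active? d x j s ≡ true
  active?-true x j s j≤r with toℕ j ≤? rank d x s
  ... | yes _   = refl
  ... | no j≰r = ⊥-elim (j≰r j≤r)

  active?-false : ∀ x j s → rank d x s < toℕ j → active? d x j s ≡ false
  active?-false x j s r<j with toℕ j ≤? rank d x s
  ... | yes j≤r = ⊥-elim (<⇒≱ r<j j≤r)
  ... | no _    = refl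

  active?-rank-cong : ∀ x y j s → rank d x s ≡ rank d y s → active? d x j s ≡ active? d y j s
  active?-rank-cong x y j s eq with toℕ j ≤? rank d x s
  ... | yes j≤r = sym (active?-true y j s (subst (toℕ j ≤_) eq j≤r))
  ... | no j≰r  = sym (active?-false y j s (subst (_< toℕ j) eq (≰⇒> j≰r)))

  _∈Δ_ : ℕ → Vec ℕ d → Set
  H ∈Δ x = height d x (seat d H) ≡ H

  search≡next : ∀ x j f c → search d x j f c ≡ next (active? d x j) f c
  search≡next x j zero    c = refl
  search≡next x j (suc f) c with active? d x j (seat d c)
  ... | true  = refl
  ... | false = search≡next x j f (suc c)

  newPoint≡advance : ∀ x j i → newPoint d x j i ≡ advance (active? d x j) (height d x i)
  newPoint≡advance x j i with active? d x j i in Ai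
  ... | true  = trans (search≡next x j d _) (sym (advance-active A (trans (cong A (seat-height x i)) Ai)))
    where A = active? d x j
  ... | false = sym (advance-inactive A (trans (cong A (seat-height x i)) Ai))
    where A = active? d x j

  levelAt-unique : ∀ Hs k {H} → H ∈ Hs → seat d H ≡ k →
                   (∀ {H'} → H' ∈ Hs → seat d H' ≡ k → H' ≡ H) → levelAt d Hs k ≡ level d H
  levelAt-unique (H₀ ∷ Hs) k H∈Hs seat-H≡k unique with seat d H₀ Fin.≟ k
  ... | yes seat-H₀≡k = cong (level d) (unique (here refl) seat-H₀≡k)
  ... | no seat-H₀≢k with H∈Hs
  ...   | here refl  = ⊥-elim (seat-H₀≢k seat-H≡k)
  ...   | there H∈Hs′ = levelAt-unique Hs k H∈Hs′ seat-H≡k (unique ∘ there)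

  module OneStep (x : Vec ℕ d) (j : Fin d) where

    A : Fin d → Bool
    A = active? d x j

    moved : Fin d → ℕ
    moved i = advance A (height d x i)

    newSeat : Fin d → Fin d
    newSeat i = seat d (moved i)

    A-height : ∀ i → A (seat d (height d x i)) ≡ A i
    A-height i = cong A (seat-height x i)

    moved-inactive : ∀ {i} → A i ≡ false → moved i ≡ height d x i
    moved-inactive {i} Ai = advance-inactive A (trans (A-height i) Ai)

    newSeat-inactive : ∀ {i} → A i ≡ false → newSeat i ≡ i
    newSeat-inactive {i} Ai = trans (cong (seat d) (moved-inactive Ai)) (seat-height x i)

    newSeat-active : ∀ {i} → A i ≡ true → A (newSeat i) ≡ true
    newSeat-active {i} Ai = advance-seat-active A (trans (A-height i) Ai)

    newSeat-injective : Injective _≡_ _≡_ newSeat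
    newSeat-injective {i} {i'} eq with A i Boolₚ.≟ true | A i' Boolₚ.≟ true
    ... | yes Ai | yes Ai' = trans (sym (seat-height x i)) (trans
          (seat-advance-injective A (trans (A-height i) Ai) (trans (A-height i') Ai') eq)
          (seat-height x i'))
    ... | yes Ai | no ¬Ai' = ⊥-elim (¬Ai' (subst (λ s → A s ≡ true)
          (trans eq (newSeat-inactive (Boolₚ.¬-not ¬Ai'))) (newSeat-active Ai)))
    ... | no ¬Ai | yes Ai' = ⊥-elim (¬Ai (subst (λ s → A s ≡ true)
          (trans (sym eq) (newSeat-inactive (Boolₚ.¬-not ¬Ai))) (newSeat-active Ai')))
    ... | no ¬Ai | no ¬Ai' =
          trans (sym (newSeat-inactive (Boolₚ.¬-not ¬Ai))) (trans eq (newSeat-inactive (Boolₚ.¬-not ¬Ai')))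

    newSeat-surjective : ∀ s → ∃ λ i → newSeat i ≡ s
    newSeat-surjective = injective⇒surjective newSeat newSeat-injective

    x′ : Vec ℕ d
    x′ = g d j x

    height-g : ∀ i → height d x′ (newSeat i) ≡ moved i
    height-g i = height-level x′ (moved i) (begin
      lookup x′ (newSeat i)         ≡⟨ Vecₚ.lookup∘tabulate (levelAt d points) (newSeat i) ⟩
      levelAt d points (newSeat i)  ≡⟨ levelAt-unique points (newSeat i) i∈points seat-i unique ⟩
      level d (newPoint d x j i)    ≡⟨ cong (level d) (newPoint≡advance x j i) ⟩
      level d (moved i)             ∎)
      where
      open ≡-Reasoning
      points = map (newPoint d x j) (allFin d)
      i∈points = ∈-map⁺ (newPoint d x j) (∈-allFin i)
      seat-i = cong (seat d) (newPoint≡advance x j i)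
      unique : ∀ {H'} → H' ∈ points → seat d H' ≡ newSeat i → H' ≡ newPoint d x j i
      unique H'∈ seat-H'≡ with ∈-map⁻ (newPoint d x j) H'∈
      ... | i' , _ , refl = cong (newPoint d x j)
              (newSeat-injective (trans (cong (seat d) (sym (newPoint≡advance x j i'))) seat-H'≡))

    lookup-g-inactive : ∀ {i} → A i ≡ false → lookup x′ i ≡ lookup x i
    lookup-g-inactive {i} Ai = height-injective x′ x i (subst (λ k → height d x′ k ≡ height d x i)
      (newSeat-inactive Ai) (trans (height-g i) (moved-inactive Ai)))

    height-g-preimage : ∀ s → ∃ λ i → newSeat i ≡ s × height d x′ s ≡ moved i
    height-g-preimage s with newSeat-surjective s
    ... | i , refl = i , refl , height-g i

    advance-∈Δ-g : ∀ {H} → H ∈Δ x → advance A H ∈Δ x′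
    advance-∈Δ-g {H} H∈x = subst (λ K → advance A K ∈Δ x′) H∈x (height-g (seat d H))

    countBelow-g : ∀ {T t} → (∀ i → moved i < T → height d x i < t) →
                   (∀ i → height d x i < t → moved i < T) → countBelow x′ T ≡ countBelow x t
    countBelow-g {T} {t} moved<T⇒ ⇒moved<T = begin
      countBelow x′ T
        ≡⟨ length-filter-permute (λ s → height d x′ s <? T) newSeat newSeat-injective ⟩
      length (filter (λ i → height d x′ (newSeat i) <? T) (allFin d))
        ≡⟨ cong length (Listₚ.filter-≐ _ _ same-points (allFin d)) ⟩
      countBelow x t
        ∎
      where
      open ≡-Reasoning
      same-points : (λ i → height d x′ (newSeat i) < T) ≐ (λ i → height d x i < t)
      same-points = (λ {i} h′<T → moved<T⇒ i (subst (_< T) (height-g i) h′<T))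
                  , (λ {i} h<t → subst (_< T) (sym (height-g i)) (⇒moved<T i h<t))

  record AgreeBelow (t : ℕ) (x y : Vec ℕ d) : Set where
    field
      lookup-≡ˡ : ∀ s → height d x s < t → lookup x s ≡ lookup y s
      lookup-≡ʳ : ∀ s → height d y s < t → lookup x s ≡ lookup y s

  open AgreeBelow public

  agreeBelow-refl : ∀ {t x} → AgreeBelow t x x
  agreeBelow-refl = record { lookup-≡ˡ = λ _ _ → refl ; lookup-≡ʳ = λ _ _ → refl }

  agreeBelow-sym : ∀ {t x y} → AgreeBelow t x y → AgreeBelow t y x
  agreeBelow-sym x≈y = record
    { lookup-≡ˡ = λ s → sym ∘ lookup-≡ʳ x≈y s
    ; lookup-≡ʳ = λ s → sym ∘ lookup-≡ˡ x≈y s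
    }

  agreeBelow-trans : ∀ {t x y z} → AgreeBelow t x y → AgreeBelow t y z → AgreeBelow t x z
  agreeBelow-trans {t} {x} {y} {z} x≈y y≈z = record { lookup-≡ˡ = from-x ; lookup-≡ʳ = from-z }
    where
    from-x : ∀ s → height d x s < t → lookup x s ≡ lookup z s
    from-x s hx<t = let xs≡ys = lookup-≡ˡ x≈y s hx<t in
      trans xs≡ys (lookup-≡ˡ y≈z s (subst (_< t) (height-cong x y s xs≡ys) hx<t))
    from-z : ∀ s → height d z s < t → lookup x s ≡ lookup z s
    from-z s hz<t = let ys≡zs = lookup-≡ʳ y≈z s hz<t in
      trans (lookup-≡ʳ x≈y s (subst (_< t) (height-cong z y s (sym ys≡zs)) hz<t)) ys≡zs

  agreeBelow-weaken : ∀ {t t' x y} → t' ≤ t → AgreeBelow t x y → AgreeBelow t' x y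
  agreeBelow-weaken t'≤t x≈y = record
    { lookup-≡ˡ = λ s h<t' → lookup-≡ˡ x≈y s (<-≤-trans h<t' t'≤t)
    ; lookup-≡ʳ = λ s h<t' → lookup-≡ʳ x≈y s (<-≤-trans h<t' t'≤t)
    }

  countBelow-agree : ∀ {t x y H} → AgreeBelow t x y → H ≤ t → countBelow x H ≡ countBelow y H
  countBelow-agree {t} {x} {y} {H} x≈y H≤t = cong length (Listₚ.filter-≐ _ _ same-points (allFin d))
    where
    same-points : (λ i → height d x i < H) ≐ (λ i → height d y i < H)
    same-points = (λ {i} hx<H → subst (_< H) (height-cong x y i (lookup-≡ˡ x≈y i (<-≤-trans hx<H H≤t))) hx<H)
                , (λ {i} hy<H → subst (_< H) (sym (height-cong x y i (lookup-≡ʳ x≈y i (<-≤-trans hy<H H≤t)))) hy<H)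

  module _ (w : Vec ℕ d) (j : Fin d) where

    open OneStep w j

    g-agreeBelow : ∀ {t} → (∀ i → height d w i < t → rank d w i < toℕ j) → AgreeBelow t w x′
    g-agreeBelow {t} low-inactive = record { lookup-≡ˡ = from-w ; lookup-≡ʳ = from-x′ }
      where
      inactive : ∀ {i} → height d w i < t → A i ≡ false
      inactive {i} h<t = active?-false w j i (low-inactive i h<t)
      from-w : ∀ s → height d w s < t → lookup w s ≡ lookup x′ s
      from-w s h<t = sym (lookup-g-inactive (inactive h<t))
      from-x′ : ∀ s → height d x′ s < t → lookup w s ≡ lookup x′ s
      from-x′ s h′<t with height-g-preimage s
      ... | i , refl , h′≡moved =
        sym (subst (λ k → lookup x′ k ≡ lookup w k) (sym (newSeat-inactive Ai)) (lookup-g-inactive Ai))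
        where
        Ai : A i ≡ false
        Ai = inactive (≤-<-trans (advance-≥ A (height d w i)) (subst (_< t) h′≡moved h′<t))

    g-vacates : ∀ {t} → countBelow w t ≡ toℕ j → ¬ t ∈Δ x′
    g-vacates {t} count≡j t∈x′ with height-g-preimage (seat d t)
    ... | i , _ , h′≡moved = moved≢t (height d w i <? t) (trans (sym h′≡moved) t∈x′)
      where
      moved≢t : Dec (height d w i < t) → moved i ≢ t
      moved≢t (yes h<t) moved≡t = <-irrefl moved≡t (subst (_< t) (sym (moved-inactive Ai)) h<t)
        where
        Ai : A i ≡ false
        Ai = active?-false w j i (subst (rank d w i <_) count≡j (rank<countBelow w i h<t))
      moved≢t (no h≮t) moved≡t =
        <-irrefl (sym moved≡t) (≤-<-trans (≮⇒≥ h≮t) (advance-> A (trans (A-height i) Ai)))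
        where
        Ai : A i ≡ true
        Ai = active?-true w j i (subst (_≤ rank d w i) count≡j (countBelow-mono-≤ w (≮⇒≥ h≮t)))

  record Separated (k t : ℕ) (z z' : Vec ℕ d) : Set where
    field
      agreeBelow : AgreeBelow t z z'
      ∈Δˡ        : t ∈Δ z
      ∉Δʳ        : ¬ t ∈Δ z'
      k≤count    : k ≤ countBelow z t

  separated-irreflexive : ∀ {k t z} → ¬ Separated k t z z
  separated-irreflexive sep = Separated.∉Δʳ sep (Separated.∈Δˡ sep)

  module SeparatedStep {k t z z'} (sep : Separated k t z z') (j : Fin d) (j≤k : toℕ j ≤ k) where

    open Separated sep renaming (agreeBelow to z≈z'; ∈Δˡ to t∈z; ∉Δʳ to t∉z')

    module Z = OneStep z j
    module Z' = OneStep z' j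
    open Z using (A)

    count-z' : countBelow z' t ≡ countBelow z t
    count-z' = sym (countBelow-agree z≈z' ≤-refl)

    active-above : ∀ w → countBelow w t ≡ countBelow z t →
                   ∀ s → t ≤ height d w s → active? d w j s ≡ true
    active-above w count≡ s t≤h = active?-true w j s (begin
      toℕ j                    ≤⟨ j≤k ⟩
      k                        ≤⟨ k≤count ⟩
      countBelow z t           ≡⟨ count≡ ⟨
      countBelow w t           ≤⟨ countBelow-mono-≤ w t≤h ⟩
      rank d w s               ∎)
      where open ≤-Reasoning

    A-agree : ∀ s → A s ≡ Z'.A s
    A-agree s = by-height (height d z s <? t)
      where
      by-height : Dec (height d z s < t) → A s ≡ Z'.A s
      by-height (yes h<t) = active?-rank-cong z z' j s (begin
        countBelow z (height d z s)    ≡⟨ countBelow-agree z≈z' (<⇒≤ h<t) ⟩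
        countBelow z' (height d z s)   ≡⟨ cong (countBelow z') (height-cong z z' s (lookup-≡ˡ z≈z' s h<t)) ⟩
        countBelow z' (height d z' s)  ∎)
        where open ≡-Reasoning
      by-height (no h≮t) = trans (active-above z refl s (≮⇒≥ h≮t)) (sym (active-above z' count-z' s t≤h'))
        where
        t≤h' : t ≤ height d z' s
        t≤h' = ≮⇒≥ λ h'<t → h≮t (subst (_< t) (height-cong z' z s (sym (lookup-≡ʳ z≈z' s h'<t))) h'<t)

    active-above-z : ∀ i → t ≤ height d z i → A i ≡ true
    active-above-z = active-above z refl

    active-above-z' : ∀ i → t ≤ height d z' i → A i ≡ true
    active-above-z' i t≤h = trans (A-agree i) (active-above z' count-z' i t≤h)

    seat-active-above : ∀ w i → (t ≤ height d w i → A i ≡ true) →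
                        t ≤ height d w i → A (seat d (height d w i)) ≡ true
    seat-active-above w i active t≤h = trans (cong A (seat-height w i)) (active t≤h)

    At : A (seat d t) ≡ true
    At = active-above-z (seat d t) (≤-reflexive (sym t∈z))

    t̂ : ℕ
    t̂ = advance A t

    moved-z' : ∀ i → Z'.moved i ≡ advance A (height d z' i)
    moved-z' i = sym (advance-cong A-agree (height d z' i))

    moved-common : ∀ i → lookup z i ≡ lookup z' i → Z'.moved i ≡ Z.moved i
    moved-common i zi≡z'i = trans (moved-z' i) (cong (advance A) (height-cong z' z i (sym zi≡z'i)))

    lookup-common : ∀ i → lookup z i ≡ lookup z' i →
                    lookup Z.x′ (Z.newSeat i) ≡ lookup Z'.x′ (Z.newSeat i)
    lookup-common i zi≡z'i = height-injective Z.x′ Z'.x′ (Z.newSeat i) (begin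
      height d Z.x′ (Z.newSeat i)    ≡⟨ Z.height-g i ⟩
      Z.moved i                      ≡⟨ moved-common i zi≡z'i ⟨
      Z'.moved i                     ≡⟨ Z'.height-g i ⟨
      height d Z'.x′ (Z'.newSeat i)  ≡⟨ cong (height d Z'.x′ ∘ seat d) (moved-common i zi≡z'i) ⟩
      height d Z'.x′ (Z.newSeat i)   ∎)
      where open ≡-Reasoning

    agreeBelow-g : AgreeBelow t̂ Z.x′ Z'.x′
    agreeBelow-g = record { lookup-≡ˡ = from-z ; lookup-≡ʳ = from-z' }
      where
      from-z : ∀ s → height d Z.x′ s < t̂ → lookup Z.x′ s ≡ lookup Z'.x′ s
      from-z s h<t̂ with Z.height-g-preimage s
      ... | i , refl , h≡moved = lookup-common i (lookup-≡ˡ z≈z' i (advance-cancel-< A At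
              (seat-active-above z i (active-above-z i)) (subst (_< t̂) h≡moved h<t̂)))
      from-z' : ∀ s → height d Z'.x′ s < t̂ → lookup Z.x′ s ≡ lookup Z'.x′ s
      from-z' s h<t̂ with Z'.height-g-preimage s
      ... | i , refl , h≡moved = subst (λ s → lookup Z.x′ s ≡ lookup Z'.x′ s)
              (cong (seat d) (sym (moved-common i zi≡z'i))) (lookup-common i zi≡z'i)
        where
        zi≡z'i : lookup z i ≡ lookup z' i
        zi≡z'i = lookup-≡ʳ z≈z' i (advance-cancel-< A At (seat-active-above z' i (active-above-z' i))
                   (subst (_< t̂) (trans h≡moved (moved-z' i)) h<t̂))

    t̂∈Δ : t̂ ∈Δ Z.x′
    t̂∈Δ = Z.advance-∈Δ-g t∈z

    t̂∉Δ : ¬ t̂ ∈Δ Z'.x′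
    t̂∉Δ t̂∈ with Z'.height-g-preimage (seat d t̂)
    ... | i , _ , h≡moved = t∉z' (subst (λ s → height d z' s ≡ t) i≡seat-t h'≡t)
      where
      h'≡t : height d z' i ≡ t
      h'≡t = advance-injective A At (seat-active-above z' i (active-above-z' i))
               (trans (sym (moved-z' i)) (trans (sym h≡moved) t̂∈))
      i≡seat-t : i ≡ seat d t
      i≡seat-t = trans (sym (seat-height z' i)) (cong (seat d) h'≡t)

    k≤countBelow-g : k ≤ countBelow Z.x′ t̂
    k≤countBelow-g = subst (k ≤_) (sym (Z.countBelow-g
      (λ i → advance-cancel-< A At (seat-active-above z i (active-above-z i)))
      (λ i h<t → advance-mono-< A h<t At))) k≤count

    separated-g : Separated k t̂ Z.x′ Z'.x′
    separated-g = record
      { agreeBelow = agreeBelow-g ; ∈Δˡ = t̂∈Δ ; ∉Δʳ = t̂∉Δ ; k≤count = k≤countBelow-g }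

  iter-preserves : ∀ {C : Set} (P : C → Set) (f : C → C) → (∀ {c} → P c → P (f c)) →
                   ∀ m {c} → P c → P (iter d f m c)
  iter-preserves P f pres zero    Pc = Pc
  iter-preserves P f pres (suc m) Pc = pres (iter-preserves P f pres m Pc)

  iter-preserves₂ : ∀ {C : Set} (R : C → C → Set) (f : C → C) → (∀ {c c'} → R c c' → R (f c) (f c')) →
                    ∀ m {c c'} → R c c' → R (iter d f m c) (iter d f m c')
  iter-preserves₂ R f pres zero    Rcc' = Rcc'
  iter-preserves₂ R f pres (suc m) Rcc' = pres (iter-preserves₂ R f pres m Rcc')

  iter-+ : ∀ {C : Set} (f : C → C) m n c → iter d f (m + n) c ≡ iter d f m (iter d f n c)
  iter-+ f zero    n c = refl
  iter-+ f (suc m) n c = cong f (iter-+ f m n c)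

  stepAt : Vec ℕ d → Fin d → Vec ℕ d → Vec ℕ d
  stepAt a j = iter d (g d j) (lookup a j)

  Apart : ℕ → Vec ℕ d → Vec ℕ d → Set
  Apart k z z' = ∃ λ t → Separated k t z z'

  apart-irreflexive : ∀ {k z} → ¬ Apart k z z
  apart-irreflexive (_ , sep) = separated-irreflexive sep

  apart-iter : ∀ {k} j → toℕ j ≤ k → ∀ m {z z'} → Apart k z z' →
               Apart k (iter d (g d j) m z) (iter d (g d j) m z')
  apart-iter {k} j j≤k =
    iter-preserves₂ (Apart k) (g d j) (λ (_ , sep) → _ , SeparatedStep.separated-g sep j j≤k)

  apart-foldr : ∀ {k} a b {z z' js} → All (λ j → toℕ j ≤ k × lookup a j ≡ lookup b j) js →
                Apart k z z' → Apart k (foldr (stepAt a) z js) (foldr (stepAt b) z' js)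
  apart-foldr {k} a b = foldr-preserves₂ (Apart k) (stepAt a) (stepAt b) apart-stepAt
    where
    apart-stepAt : ∀ {j z z'} → toℕ j ≤ k × lookup a j ≡ lookup b j → Apart k z z' →
                   Apart k (stepAt a j z) (stepAt b j z')
    apart-stepAt {j} {z} {z'} (j≤k , aj≡bj) apart =
      subst (λ m → Apart k (stepAt a j z) (iter d (g d j) m z')) aj≡bj (apart-iter j j≤k (lookup a j) apart)

  agreeBelow-g-above : ∀ {t x w} j → countBelow x t < toℕ j →
                       AgreeBelow (suc t) x w → AgreeBelow (suc t) x (g d j w)
  agreeBelow-g-above {t} {x} {w} j count<j x≈w = agreeBelow-trans x≈w (g-agreeBelow w j low-inactive)
    where
    low-inactive : ∀ i → height d w i < suc t → rank d w i < toℕ j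
    low-inactive i h<1+t = begin-strict
      rank d w i       ≤⟨ countBelow-mono-≤ w (≤-pred h<1+t) ⟩
      countBelow w t   ≡⟨ countBelow-agree x≈w (n≤1+n t) ⟨
      countBelow x t   <⟨ count<j ⟩
      toℕ j            ∎
      where open ≤-Reasoning

  agreeBelow-foldr-above : ∀ {t} a x {js} → All (λ j → countBelow x t < toℕ j) js →
                           AgreeBelow (suc t) x (foldr (stepAt a) x js)
  agreeBelow-foldr-above {t} a x all-above = foldr-preserves (AgreeBelow (suc t) x) (stepAt a)
    (λ {j} count<j → iter-preserves (AgreeBelow (suc t) x) (g d j) (agreeBelow-g-above j count<j) (lookup a j))
    all-above agreeBelow-refl

  agreeBelow-g-at : ∀ {t x w} j → countBelow x t ≡ toℕ j → AgreeBelow t x w → AgreeBelow t x (g d j w)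
  agreeBelow-g-at {t} {x} {w} j count≡j x≈w = agreeBelow-trans x≈w (g-agreeBelow w j below-inactive)
    where
    below-inactive : ∀ i → height d w i < t → rank d w i < toℕ j
    below-inactive i h<t =
      subst (rank d w i <_) (trans (sym (countBelow-agree x≈w ≤-refl)) count≡j) (rank<countBelow w i h<t)

  -- y keeps the point t of x while the extra g_k's remove it from y'.
  separated-start : ∀ {t x y y'} k → t ∈Δ x → countBelow x t ≡ toℕ k →
                    AgreeBelow (suc t) x y → AgreeBelow (suc t) x y' → ∀ c →
                    Separated (toℕ k) t y (iter d (g d k) (suc c) y')
  separated-start {t} {x} {y} {y'} k t∈x count≡k x≈y x≈y' c = record
    { agreeBelow = agreeBelow-trans (agreeBelow-sym (agreeBelow-weaken (n≤1+n t) x≈y))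
                                    (agreeBelow-g-at k count≡k x≈w)
    ; ∈Δˡ        = trans (height-cong y x (seat d t) (sym xt≡yt)) t∈x
    ; ∉Δʳ        = g-vacates w k (trans (sym (countBelow-agree x≈w ≤-refl)) count≡k)
    ; k≤count    = ≤-reflexive (trans (sym count≡k) (countBelow-agree x≈y (n≤1+n t)))
    }
    where
    xt≡yt : lookup x (seat d t) ≡ lookup y (seat d t)
    xt≡yt = lookup-≡ˡ x≈y (seat d t) (subst (_< suc t) (sym t∈x) (n<1+n t))
    w = iter d (g d k) c y'
    x≈w : AgreeBelow t x w
    x≈w = iter-preserves (AgreeBelow t x) (g d k) (agreeBelow-g-at k count≡k) c
                         (agreeBelow-weaken (n≤1+n t) x≈y')

  gPow-split : ∀ a x {k pre suf} → allFin d ≡ pre ++ k ∷ suf →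
               gPow d a x ≡ foldr (stepAt a) (stepAt a k (foldr (stepAt a) x suf)) pre
  gPow-split a x {k} {pre} {suf} allFin≡ =
    trans (cong (foldr (stepAt a) x) allFin≡) (Listₚ.foldr-++ (stepAt a) x pre (k ∷ suf))

  gPow-≢-first-difference : ∀ a b x k → (∀ j → j Fin.< k → lookup a j ≡ lookup b j) →
                            lookup a k < lookup b k → gPow d a x ≢ gPow d b x
  gPow-≢-first-difference a b x k a≡b-below ak<bk gPow≡
    with allFin-split k | rank-surjective x k | m≤n⇒∃[o]m+o≡n ak<bk
  ... | pre , suf , allFin≡ , pre<k , k<suf | i , rank≡k | c , 1+ak+c≡bk =
    apart-irreflexive (subst (Apart (toℕ k) (gPow d a x)) (sym gPow≡) apart-gPow)
    where
    t = height d x i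
    y = foldr (stepAt a) x suf
    y' = foldr (stepAt b) x suf
    above-t : All (λ j → countBelow x t < toℕ j) suf
    above-t = All.map (subst (_< _) (sym rank≡k)) k<suf
    separated-suffix : Separated (toℕ k) t y (iter d (g d k) (suc c) y')
    separated-suffix = separated-start k (cong (height d x) (seat-height x i)) rank≡k
      (agreeBelow-foldr-above a x above-t) (agreeBelow-foldr-above b x above-t) c
    stepAt-b-k : iter d (g d k) (lookup a k) (iter d (g d k) (suc c) y') ≡ stepAt b k y'
    stepAt-b-k = begin
      iter d (g d k) (lookup a k) (iter d (g d k) (suc c) y')  ≡⟨ iter-+ (g d k) (lookup a k) (suc c) y' ⟨
      iter d (g d k) (lookup a k + suc c) y'                   ≡⟨ cong iterₖ (+-suc (lookup a k) c) ⟩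
      iter d (g d k) (suc (lookup a k) + c) y'                 ≡⟨ cong iterₖ 1+ak+c≡bk ⟩
      stepAt b k y'                                            ∎
      where
      open ≡-Reasoning
      iterₖ = λ m → iter d (g d k) m y'
    apart-k : Apart (toℕ k) (stepAt a k y) (stepAt b k y')
    apart-k = subst (Apart (toℕ k) (stepAt a k y)) stepAt-b-k
                    (apart-iter k ≤-refl (lookup a k) (t , separated-suffix))
    apart-gPow : Apart (toℕ k) (gPow d a x) (gPow d b x)
    apart-gPow = subst₂ (Apart (toℕ k)) (sym (gPow-split a x allFin≡)) (sym (gPow-split b x allFin≡))
      (apart-foldr a b (All.map (λ {j} j<k → <⇒≤ j<k , a≡b-below j j<k) pre<k) apart-k)

  gPow-lookup-injective : ∀ x a b → gPow d a x ≡ gPow d b x → ∀ k → lookup a k ≡ lookup b k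
  gPow-lookup-injective x a b gPow≡ = All.wfRec FinInduction.<-wellFounded _ (λ k → lookup a k ≡ lookup b k) step
    where
    step : ∀ k → (∀ {j} → j Fin.< k → lookup a j ≡ lookup b j) → lookup a k ≡ lookup b k
    step k a≡b-below with <-cmp (lookup a k) (lookup b k)
    ... | tri< ak<bk _ _ = ⊥-elim (gPow-≢-first-difference a b x k (λ _ → a≡b-below) ak<bk gPow≡)
    ... | tri≈ _ ak≡bk _ = ak≡bk
    ... | tri> _ _ bk<ak =
          ⊥-elim (gPow-≢-first-difference b a x k (λ _ → sym ∘ a≡b-below) bk<ak (sym gPow≡))

corollary4p4 : (d : ℕ) .{{_ : NonZero d}} (x a b : Vec ℕ d) →
    gPow d a x ≡ gPow d b x → a ≡ b
corollary4p4 d x a b gPow≡ = begin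
  a                        ≡⟨ Vecₚ.tabulate∘lookup a ⟨
  Vec.tabulate (lookup a)  ≡⟨ Vecₚ.tabulate-cong (gPow-lookup-injective d x a b gPow≡) ⟩
  Vec.tabulate (lookup b)  ≡⟨ Vecₚ.tabulate∘lookup b ⟩
  b                        ∎
  where open ≡-Reasoning
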